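{- Let $q_1(x)=0,\dots,q_s(x)=0$ be quadratic equations over $\mathbb{F}_2$ in variables $x_1,\dots,x_m$, and let $Q_1,\dots,Q_s\in\mathbb{F}_2^{(m+1)\times(m+1)}$ be their matrix forms. Suppose $A\in\mathbb{F}_2^{(m+1)\times(m+1)}$ is a pseudo-quadratic matrix with $\mathrm{rank}(A)\le k$ and $\langle Q_i,A\rangle=0$ for all $i\in[s]$. Then there exist an integer $l<3k/2+1$ and vectors $a^{(1)},\dots,a^{(l)}\in\mathbb{F}_2^{m+1}$ such that $A=\sum_{i=1}^l a^{(i)}\otimes a^{(i)}$, and for all $j\in[l]$, $a^{(j)}_1=1$ and $D_1(a^{(j)})$ lies in the column space of $D_1(A)$. In particular, the assignments $D_1(a^{(1)}),\dots,D_1(a^{(l)})$ satisfy all the equations $q_1(x)=0,\dots,q_s(x)=0$ in superposition.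
   Context: A quadratic equation is $q(x)=c+\sum_{i=1}^m c_ix_i+\sum_{1\le i<j\le m}c_{ij}x_ix_j=0$ with coefficients in $\mathbb{F}_2$. Its matrix form is $C\in\mathbb{F}_2^{(m+1)\times(m+1)}$ with $C_{1,1}=c$, $C_{1,i}=c_{i-1}$ for $i=2,\dots,m+1$, $C_{i,j}=c_{i-1,j-1}$ for $2\le i<j\le m+1$, and all other entries $0$. For matrices, $\langle C,A\rangle=\sum_{i,j}C_{ij}A_{ij}$ (entrywise dot product over $\mathbb{F}_2$). Assignments $a^{(1)},\dots,a^{(t)}\in\mathbb{F}_2^m$ satisfy $q(x)=0$ in superposition if $c+\sum_i c_i\sum_{l=1}^t a^{(l)}_i+\sum_{i<j}c_{ij}\sum_{l=1}^t a^{(l)}_ia^{(l)}_j=0$. A matrix $A\in\mathbb{F}_2^{(m+1)\times(m+1)}$ is pseudo-quadratic if it is symmetric, $A_{1,1}=1$, and $A_{1,i}=A_{i,1}=A_{i,i}$ for $i=2,\dots,m+1$. $D_1$ removes the first coordinate of a vector, and the first row and column of a matrix; $u\otimes w$ denotes the matrix $(u_iw_j)_{i,j}$. -}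

module Defs where

open import Data.Bool using (Bool; true; false; _xor_; _∧_; if_then_else_)
open import Data.Nat using (ℕ; zero; suc; _<ᵇ_; _≤_)
open import Data.Fin using (Fin; zero; suc; toℕ)
open import Data.Product using (Σ; ∃)
open import Relation.Binary.PropositionalEquality using (_≡_)

-- The field F₂ is modelled by Bool: addition = _xor_, multiplication = _∧_,
-- zero = false, one = true.
F₂ : Set
F₂ = Bool

Vec₂ : ℕ → Set
Vec₂ n = Fin n → F₂

Mat₂ : ℕ → ℕ → Set
Mat₂ r c = Fin r → Fin c → F₂

Σ₂ : (n : ℕ) → (Fin n → F₂) → F₂
Σ₂ zero    f = false
Σ₂ (suc n) f = f zero xor Σ₂ n (λ i → f (suc i))

Σ₂< : (m : ℕ) → (Fin m → Fin m → F₂) → F₂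
Σ₂< m f = Σ₂ m (λ i → Σ₂ m (λ j → if toℕ i <ᵇ toℕ j then f i j else false))

-- A quadratic equation q(x) = c + Σ c_i x_i + Σ_{i<j} c_ij x_i x_j = 0
-- in variables x_1..x_m (index 0..m-1 here). Only the entries quad i j with
-- i < j are used.
record Quadratic (m : ℕ) : Set where
  field
    const : F₂
    lin   : Fin m → F₂
    quad  : Fin m → Fin m → F₂
open Quadratic public

-- Matrix form C ∈ F₂^{(m+1)×(m+1)}; index zero plays the role of index 1.
matrixForm : {m : ℕ} → Quadratic m → Mat₂ (suc m) (suc m)
matrixForm q zero    zero    = const q
matrixForm q zero    (suc j) = lin q j
matrixForm q (suc i) zero    = false
matrixForm q (suc i) (suc j) = if toℕ i <ᵇ toℕ j then quad q i j else false

⟨_,_⟩ : {r c : ℕ} → Mat₂ r c → Mat₂ r c → F₂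
⟨_,_⟩ {r} {c} C A = Σ₂ r (λ i → Σ₂ c (λ j → C i j ∧ A i j))

SatisfiesInSuperposition : {m t : ℕ} → Quadratic m → (Fin t → Vec₂ m) → Set
SatisfiesInSuperposition {m} {t} q a =
  (const q
    xor Σ₂ m (λ i → lin q i ∧ Σ₂ t (λ l → a l i))
    xor Σ₂< m (λ i j → quad q i j ∧ Σ₂ t (λ l → a l i ∧ a l j)))
  ≡ false

record PseudoQuadratic {m : ℕ} (A : Mat₂ (suc m) (suc m)) : Set where
  field
    symmetric : ∀ i j → A i j ≡ A j i
    corner    : A zero zero ≡ true
    rowDiag   : ∀ i → A zero (suc i) ≡ A (suc i) (suc i)
    colDiag   : ∀ i → A (suc i) zero ≡ A (suc i) (suc i)

D₁ᵛ : {m : ℕ} → Vec₂ (suc m) → Vec₂ m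
D₁ᵛ v i = v (suc i)

D₁ᵐ : {m : ℕ} → Mat₂ (suc m) (suc m) → Mat₂ m m
D₁ᵐ A i j = A (suc i) (suc j)

_⊗_ : {r c : ℕ} → Vec₂ r → Vec₂ c → Mat₂ r c
(u ⊗ w) i j = u i ∧ w j

InColumnSpace : {r c : ℕ} → Mat₂ r c → Vec₂ r → Set
InColumnSpace {r} {c} M v = ∃ λ (x : Vec₂ c) → ∀ i → v i ≡ Σ₂ c (λ j → M i j ∧ x j)

LinearlyIndependent : {n d : ℕ} → (Fin n → Vec₂ d) → Set
LinearlyIndependent {n} {d} v =
  (λc : Vec₂ n) → (∀ i → Σ₂ n (λ r → λc r ∧ v r i) ≡ false) → ∀ r → λc r ≡ false

RankAtMost : {r c : ℕ} → Mat₂ r c → ℕ → Set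
RankAtMost {r} {c} A k =
  (n : ℕ) (cols : Fin n → Fin c) →
  LinearlyIndependent (λ t i → A i (cols t)) → n ≤ k

module Submission where

-- The theorem rests on a structure theorem for symmetric matrices M over F₂
-- (applied to M = D₁ A): M = Σᵣ wᵣ ⊗ wᵣ with every wᵣ in the column space of
-- M, using l squares against r independent columns of M, where 2l < 3r, or
-- 2l ≤ 3r when M is alternating.
-- Depending on the first row (M₁₁ = 1; a zero row; M₁q = 1 with M_qq = 1;
-- M₁q = 1 with M_qq = 0, a hyperbolic plane) one splits off 1, 0, 2 or 3
-- squares of vectors of the column space, leaving a symmetric matrix with
-- zero first row, which is handled by induction.  The remainder arises from
-- M by column operations, so its column space lies in that of M, and a single
-- lemma (independent-extend) shows how such an operation raises the number of
-- independent columns.  Finally the decomposition of D₁ A is made odd in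
-- length and extended by a leading 1 to a decomposition of A (this is where
-- A being pseudo-quadratic enters), rank A ≤ k bounds its length, and
-- ⟨Qᵢ, A⟩ = 0 is exactly the superposition condition for qᵢ.

open import Defs
open import Data.Bool using (Bool; true; false)
open import Data.Nat using (ℕ; suc; _+_; _*_; _<_)
open import Data.Fin using (Fin; zero)
open import Data.Product using (Σ; ∃; _×_)
open import Relation.Binary.PropositionalEquality using (_≡_)

open import Algebra.Bundles using (CommutativeRing)
open import Data.Bool using (_xor_; _∧_; if_then_else_)
open import Data.Bool.Properties
  using ( _≟_; ¬-not; xor-∧-commutativeRing; ∧-zeroʳ; ∧-identityʳ; ∧-idem; ∧-comm
        ; ∧-distribˡ-xor; xor-identityʳ; xor-same; xor-assoc )
open import Data.Fin using (suc; splitAt; toℕ)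
open import Data.Fin.Properties using (all?; ¬∀⟶∃¬)
open import Data.Maybe using (Maybe; just; nothing)
open import Data.Nat using (zero; _≤_; z≤n; _<ᵇ_)
open import Data.Nat.Properties
  using ( ≤-refl; <⇒≤; <-≤-trans; ≤-<-trans; n≤1+n; n<1+n; +-comm; *-suc; *-distribˡ-+
        ; +-mono-≤; +-mono-<-≤; +-mono-≤-<; +-monoʳ-<; *-monoʳ-≤; *-monoʳ-<; module ≤-Reasoning )
open import Data.Product using (_,_; proj₁; proj₂)
open import Data.Sum using (inj₁; inj₂)
open import Data.Sum.Properties using ([,]-map)
open import Data.Vec.Functional using ([]; _∷_; _++_)
open import Function using (_∘_)
open import Relation.Binary.PropositionalEquality
  using (refl; sym; trans; cong; cong₂; subst₂; module ≡-Reasoning)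
open import Relation.Nullary using (yes; no)
open import Tactic.RingSolver using (solve-∀)
open import Tactic.RingSolver.Core.AlmostCommutativeRing using (AlmostCommutativeRing; fromCommutativeRing)

open CommutativeRing xor-∧-commutativeRing using (semiring)
open import Algebra.Properties.Semiring.Sum semiring
  using (sum; sum-cong-≗; ∑-distrib-+; *-distribˡ-sum; sum-replicate-zero)

isZero? : (b : Bool) → Maybe (false ≡ b)
isZero? false = just refl
isZero? true  = nothing

F₂-ring : AlmostCommutativeRing _ _
F₂-ring = fromCommutativeRing xor-∧-commutativeRing isZero?

xor≡false⇒≡ : ∀ {x y} → x xor y ≡ false → x ≡ y
xor≡false⇒≡ {false} {false} _ = refl
xor≡false⇒≡ {true}  {true}  _ = refl

Σ₂≡sum : ∀ n (f : Fin n → F₂) → Σ₂ n f ≡ sum f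
Σ₂≡sum zero    f = refl
Σ₂≡sum (suc n) f = cong (f zero xor_) (Σ₂≡sum n (f ∘ suc))

Σ₂-cong : ∀ n {f g : Fin n → F₂} → (∀ i → f i ≡ g i) → Σ₂ n f ≡ Σ₂ n g
Σ₂-cong n {f} {g} f≗g = trans (Σ₂≡sum n f) (trans (sum-cong-≗ f≗g) (sym (Σ₂≡sum n g)))

Σ₂-zero : ∀ n {f : Fin n → F₂} → (∀ i → f i ≡ false) → Σ₂ n f ≡ false
Σ₂-zero n {f} f≗0 = trans (Σ₂-cong n f≗0) (trans (Σ₂≡sum n _) (sum-replicate-zero n))

Σ₂-xor : ∀ n (f g : Fin n → F₂) → Σ₂ n (λ i → f i xor g i) ≡ Σ₂ n f xor Σ₂ n g
Σ₂-xor n f g = begin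
  Σ₂ n (λ i → f i xor g i) ≡⟨ Σ₂≡sum n _ ⟩
  sum (λ i → f i xor g i)  ≡⟨ ∑-distrib-+ f g ⟩
  sum f xor sum g          ≡⟨ sym (cong₂ _xor_ (Σ₂≡sum n f) (Σ₂≡sum n g)) ⟩
  Σ₂ n f xor Σ₂ n g        ∎
  where open ≡-Reasoning

Σ₂-∧ˡ : ∀ n b (f : Fin n → F₂) → Σ₂ n (λ i → b ∧ f i) ≡ b ∧ Σ₂ n f
Σ₂-∧ˡ n b f = begin
  Σ₂ n (λ i → b ∧ f i) ≡⟨ Σ₂≡sum n _ ⟩
  sum (λ i → b ∧ f i)  ≡⟨ sym (*-distribˡ-sum b f) ⟩
  b ∧ sum f            ≡⟨ cong (b ∧_) (sym (Σ₂≡sum n f)) ⟩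
  b ∧ Σ₂ n f           ∎
  where open ≡-Reasoning

Σ₂-perturb : ∀ n (λc g h : Fin n → F₂) b →
  Σ₂ n (λ t → λc t ∧ (g t xor (b ∧ h t)))
    ≡ Σ₂ n (λ t → λc t ∧ g t) xor (b ∧ Σ₂ n (λ t → λc t ∧ h t))
Σ₂-perturb n λc g h b = begin
  Σ₂ n (λ t → λc t ∧ (g t xor (b ∧ h t)))
    ≡⟨ Σ₂-cong n (λ t → distrib (λc t) (g t) b (h t)) ⟩
  Σ₂ n (λ t → (λc t ∧ g t) xor (b ∧ (λc t ∧ h t)))
    ≡⟨ Σ₂-xor n _ _ ⟩
  Σ₂ n (λ t → λc t ∧ g t) xor Σ₂ n (λ t → b ∧ (λc t ∧ h t))
    ≡⟨ cong (Σ₂ n (λ t → λc t ∧ g t) xor_) (Σ₂-∧ˡ n b _) ⟩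
  Σ₂ n (λ t → λc t ∧ g t) xor (b ∧ Σ₂ n (λ t → λc t ∧ h t)) ∎
  where
  open ≡-Reasoning
  distrib : ∀ l x c y → l ∧ (x xor (c ∧ y)) ≡ (l ∧ x) xor (c ∧ (l ∧ y))
  distrib = solve-∀ F₂-ring

Symmetric : ∀ {n} → Mat₂ n n → Set
Symmetric M = ∀ i j → M i j ≡ M j i

Alternating : ∀ {n} → Mat₂ n n → Set
Alternating M = ∀ i → M i i ≡ false

colspace-resp : ∀ {a c} {M : Mat₂ a c} {u v : Vec₂ a} →
  (∀ i → u i ≡ v i) → InColumnSpace M u → InColumnSpace M v
colspace-resp u≗v (x , hx) = x , λ i → trans (sym (u≗v i)) (hx i)

unit : ∀ {n} → Fin n → Vec₂ n
unit zero    zero    = true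
unit zero    (suc _) = false
unit (suc _) zero    = false
unit (suc j) (suc k) = unit j k

Σ₂-unit : ∀ n (f : Fin n → F₂) j → Σ₂ n (λ k → f k ∧ unit j k) ≡ f j
Σ₂-unit (suc n) f zero =
  trans (cong₂ _xor_ (∧-identityʳ (f zero)) (Σ₂-zero n (λ k → ∧-zeroʳ (f (suc k)))))
        (xor-identityʳ (f zero))
Σ₂-unit (suc n) f (suc j) =
  trans (cong (_xor Σ₂ n (λ k → f (suc k) ∧ unit j k)) (∧-zeroʳ (f zero)))
        (Σ₂-unit n (f ∘ suc) j)

colspace-column : ∀ {a c} (M : Mat₂ a c) (j : Fin c) → InColumnSpace M (λ i → M i j)
colspace-column {c = c} M j = unit j , λ i → sym (Σ₂-unit c (M i) j)

colspace-zero : ∀ {a c} {M : Mat₂ a c} → InColumnSpace M (λ _ → false)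
colspace-zero {c = c} {M} = (λ _ → false) , λ i → sym (Σ₂-zero c (λ j → ∧-zeroʳ (M i j)))

colspace-xor : ∀ {a c} {M : Mat₂ a c} {u v : Vec₂ a} →
  InColumnSpace M u → InColumnSpace M v → InColumnSpace M (λ i → u i xor v i)
colspace-xor {c = c} {M} (x , hx) (y , hy) = (λ j → x j xor y j) , λ i → begin
  _                                               ≡⟨ cong₂ _xor_ (hx i) (hy i) ⟩
  Σ₂ c (λ j → M i j ∧ x j) xor Σ₂ c (λ j → M i j ∧ y j) ≡⟨ sym (Σ₂-xor c _ _) ⟩
  Σ₂ c (λ j → (M i j ∧ x j) xor (M i j ∧ y j))    ≡⟨ Σ₂-cong c (λ j → sym (∧-distribˡ-xor (M i j) (x j) (y j))) ⟩
  Σ₂ c (λ j → M i j ∧ (x j xor y j))              ∎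
  where open ≡-Reasoning

colspace-scale : ∀ {a c} {M : Mat₂ a c} {u : Vec₂ a} (b : F₂) →
  InColumnSpace M u → InColumnSpace M (λ i → u i ∧ b)
colspace-scale {c = c} {M} b (x , hx) = (λ j → x j ∧ b) , λ i → begin
  _                                 ≡⟨ cong (_∧ b) (hx i) ⟩
  Σ₂ c (λ j → M i j ∧ x j) ∧ b      ≡⟨ sym (trans (Σ₂-cong c (λ j → reassoc (M i j) (x j) b))
                                                   (trans (Σ₂-∧ˡ c b _) (comm b _))) ⟩
  Σ₂ c (λ j → M i j ∧ (x j ∧ b))    ∎
  where
  open ≡-Reasoning
  reassoc : ∀ m p q → m ∧ (p ∧ q) ≡ q ∧ (m ∧ p)
  reassoc = solve-∀ F₂-ring
  comm : ∀ p q → p ∧ q ≡ q ∧ p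
  comm = solve-∀ F₂-ring

colspace-combination : ∀ {a c} (M : Mat₂ a c) {d} (N : Mat₂ a d) →
  (∀ j → InColumnSpace M (λ i → N i j)) →
  (x : Vec₂ d) → InColumnSpace M (λ i → Σ₂ d (λ j → N i j ∧ x j))
colspace-combination M {zero}  N cols x = colspace-zero
colspace-combination M {suc d} N cols x =
  colspace-xor (colspace-scale (x zero) (cols zero))
               (colspace-combination M (λ i j → N i (suc j)) (cols ∘ suc) (x ∘ suc))

_⊑_ : ∀ {a c d} → Mat₂ a d → Mat₂ a c → Set
N ⊑ M = ∀ {v} → InColumnSpace N v → InColumnSpace M v

columns⊑ : ∀ {a c d} {M : Mat₂ a c} {N : Mat₂ a d} →
  (∀ j → InColumnSpace M (λ i → N i j)) → N ⊑ M
columns⊑ {M = M} {N} cols (x , hx) =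
  colspace-resp (λ i → sym (hx i)) (colspace-combination M N cols x)

⊑-trans : ∀ {a c d e} {M : Mat₂ a c} {K : Mat₂ a d} {N : Mat₂ a e} → N ⊑ K → K ⊑ M → N ⊑ M
⊑-trans N⊑K K⊑M = K⊑M ∘ N⊑K

-- Column operations and independent columns.

record ColumnOp {a c} (M N : Mat₂ a c) (s : Fin c) (v : Vec₂ c) : Set where
  constructor columnOp
  field entries : ∀ i j → N i j ≡ M i j xor (M i s ∧ v j)

columnOp-⊑ : ∀ {a c} {M N : Mat₂ a c} {s v} → ColumnOp M N s v → N ⊑ M
columnOp-⊑ {M = M} {s = s} {v} (columnOp entries) = columns⊑ λ j →
  colspace-resp (λ i → sym (entries i j))
    (colspace-xor (colspace-column M j) (colspace-scale (v j) (colspace-column M s)))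

columnsAt : ∀ {a c r} → Mat₂ a c → (Fin r → Fin c) → Fin r → Vec₂ a
columnsAt M p t i = M i (p t)

IndependentColumns : ∀ {a c} → Mat₂ a c → ℕ → Set
IndependentColumns {c = c} M r = Σ (Fin r → Fin c) λ p → LinearlyIndependent (columnsAt M p)

-- For a combination
-- κ₀·Mₛ + Σ λₜ·M_{pₜ} = 0, rewriting M_{pₜ} through N gives
-- (κ₀ + μ)·Mₛ + Σ λₜ·N_{pₜ} = 0 with μ = Σ λₜ·v_{pₜ}; row w forces κ₀ = μ,
-- then independence in N forces λ = 0, hence μ = 0 and κ₀ = 0.
independent-extend : ∀ {a c r} {M N : Mat₂ a c} {s : Fin c} {v : Vec₂ c} (w : Fin a) →
  ColumnOp M N s v → M w s ≡ true → (p : Fin r → Fin c) → (∀ t → N w (p t) ≡ false) →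
  LinearlyIndependent (columnsAt N p) → LinearlyIndependent (columnsAt M (s ∷ p))
independent-extend {r = r} {M} {N} {s} {v} w (columnOp entries) Mws≡1 p Nw≡0 indepN κ combination≡0 = κ≡0
  where
  λc : Vec₂ r
  λc = κ ∘ suc
  μ : F₂
  μ = Σ₂ r (λ t → λc t ∧ v (p t))
  combN combM : Vec₂ _
  combN i = Σ₂ r (λ t → λc t ∧ N i (p t))
  combM i = Σ₂ r (λ t → λc t ∧ M i (p t))

  combN≡ : ∀ i → combN i ≡ combM i xor (M i s ∧ μ)
  combN≡ i = trans (Σ₂-cong r (λ t → cong (λc t ∧_) (entries i (p t))))
                   (Σ₂-perturb r λc (λ t → M i (p t)) (λ t → v (p t)) (M i s))

  shifted : ∀ i → ((κ zero xor μ) ∧ M i s) xor combN i ≡ false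
  shifted i = trans (cong (((κ zero xor μ) ∧ M i s) xor_) (combN≡ i))
                    (trans (regroup (κ zero) μ (M i s) (combM i)) (combination≡0 i))
    where
    regroup : ∀ k m b c → ((k xor m) ∧ b) xor (c xor (b ∧ m)) ≡ (k ∧ b) xor c
    regroup = solve-∀ F₂-ring

  combN-w≡0 : combN w ≡ false
  combN-w≡0 = Σ₂-zero r λ t → trans (cong (λc t ∧_) (Nw≡0 t)) (∧-zeroʳ (λc t))

  κ₀≡μ : κ zero ≡ μ
  κ₀≡μ = xor≡false⇒≡ (begin
    κ zero xor μ                                   ≡⟨ sym (∧-identityʳ _) ⟩
    (κ zero xor μ) ∧ true                          ≡⟨ cong ((κ zero xor μ) ∧_) (sym Mws≡1) ⟩
    (κ zero xor μ) ∧ M w s                         ≡⟨ sym (xor-identityʳ _) ⟩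
    ((κ zero xor μ) ∧ M w s) xor false             ≡⟨ cong (((κ zero xor μ) ∧ M w s) xor_) (sym combN-w≡0) ⟩
    ((κ zero xor μ) ∧ M w s) xor combN w           ≡⟨ shifted w ⟩
    false                                          ∎)
    where open ≡-Reasoning

  κ₀+μ≡0 : κ zero xor μ ≡ false
  κ₀+μ≡0 = trans (cong (κ zero xor_) (sym κ₀≡μ)) (xor-same (κ zero))

  λc≡0 : ∀ t → λc t ≡ false
  λc≡0 = indepN λc λ i → trans (cong (λ k → (k ∧ M i s) xor combN i) (sym κ₀+μ≡0)) (shifted i)

  κ≡0 : ∀ t → κ t ≡ false
  κ≡0 zero    = trans κ₀≡μ (Σ₂-zero r λ t → cong (_∧ v (p t)) (λc≡0 t))
  κ≡0 (suc t) = λc≡0 t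

Σ₂-++ : ∀ d {l} {X : Set} (u : Fin d → X) (v : Fin l → X) (F : X → F₂) →
  Σ₂ (d + l) (F ∘ (u ++ v)) ≡ Σ₂ d (F ∘ u) xor Σ₂ l (F ∘ v)
Σ₂-++ zero    u v F = refl
Σ₂-++ (suc d) {l} u v F = begin
  F (u zero) xor Σ₂ (d + l) (λ i → F ((u ++ v) (suc i)))
    ≡⟨ cong (F (u zero) xor_) (Σ₂-cong (d + l) (λ i → cong F ([,]-map (splitAt d i)))) ⟩
  F (u zero) xor Σ₂ (d + l) (F ∘ ((u ∘ suc) ++ v))
    ≡⟨ cong (F (u zero) xor_) (Σ₂-++ d (u ∘ suc) v F) ⟩
  F (u zero) xor (Σ₂ d (F ∘ u ∘ suc) xor Σ₂ l (F ∘ v))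
    ≡⟨ sym (xor-assoc (F (u zero)) _ _) ⟩
  Σ₂ (suc d) (F ∘ u) xor Σ₂ l (F ∘ v) ∎
  where open ≡-Reasoning

-- Sum-of-squares decompositions M = Σᵣ wᵣ ⊗ wᵣ.

SumOfSquares : ∀ {n l} → Mat₂ n n → (Fin l → Vec₂ n) → Set
SumOfSquares {l = l} M w = ∀ i j → M i j ≡ Σ₂ l (λ r → w r i ∧ w r j)

-- The invariant of the reduction: l squares against r independent columns,
-- 2l < 3r, or 2l ≤ 3r when M is alternating.
data Bound {n} (l r : ℕ) (M : Mat₂ n n) : Set where
  strict      : 2 * l < 3 * r → Bound l r M
  alternating : 2 * l ≤ 3 * r → Alternating M → Bound l r M

bound-weaken : ∀ {n l r} {M : Mat₂ n n} → Bound l r M → 2 * l ≤ 3 * r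
bound-weaken (strict b)        = <⇒≤ b
bound-weaken (alternating b _) = b

record Decomposition {n} (M : Mat₂ n n) : Set where
  field
    length          : ℕ
    vectors         : Fin length → Vec₂ n
    sum-of-squares  : SumOfSquares M vectors
    in-column-space : ∀ r → InColumnSpace M (vectors r)
    rank            : ℕ
    independent     : IndependentColumns M rank
    bound           : Bound length rank M

pad : ∀ {n} → Vec₂ n → Vec₂ (suc n)
pad v = false ∷ v

pad-squares : ∀ {n l} {N : Mat₂ (suc n) (suc n)} {w : Fin l → Vec₂ n} →
  Symmetric N → (∀ j → N zero j ≡ false) → SumOfSquares (D₁ᵐ N) w → SumOfSquares N (pad ∘ w)
pad-squares {l = l} symN row₀ squares zero    j       =
  trans (row₀ j) (sym (Σ₂-zero l (λ _ → refl)))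
pad-squares {l = l} {w = w} symN row₀ squares (suc i) zero    =
  trans (trans (symN (suc i) zero) (row₀ (suc i))) (sym (Σ₂-zero l (λ r → ∧-zeroʳ (w r i))))
pad-squares symN row₀ squares (suc i) (suc j) = squares i j

pad-column-space : ∀ {n} {N : Mat₂ (suc n) (suc n)} {v : Vec₂ n} →
  (∀ j → N zero j ≡ false) → InColumnSpace (D₁ᵐ N) v → InColumnSpace N (pad v)
pad-column-space {n} {N} row₀ (x , hx) = pad x , λ
  { zero    → sym (Σ₂-zero (suc n) (λ j → cong (_∧ pad x j) (row₀ j)))
  ; (suc i) → trans (hx i) (cong (_xor Σ₂ n (λ j → N (suc i) (suc j) ∧ x j))
                                 (sym (∧-zeroʳ (N (suc i) zero)))) }

unpad-independent : ∀ {n r} {N : Mat₂ (suc n) (suc n)} (p : Fin r → Fin n) →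
  LinearlyIndependent (columnsAt (D₁ᵐ N) p) → LinearlyIndependent (columnsAt N (suc ∘ p))
unpad-independent p indep κ combination≡0 = indep κ (combination≡0 ∘ suc)

-- One reduction step: M = Σᵣ partsᵣ ⊗ partsᵣ + rest, where the parts lie in
-- the column space of M and rest is symmetric with vanishing first row, so
-- that rest is determined by its block D₁ rest of smaller size; extend and
-- grow say how independent columns and the bound pass from rest to M.
record Reduction {n} (M : Mat₂ (suc n) (suc n)) : Set where
  field
    rest           : Mat₂ (suc n) (suc n)
    rest-symmetric : Symmetric rest
    rest-row₀      : ∀ j → rest zero j ≡ false
    rest⊑          : rest ⊑ M
    removed        : ℕ
    parts          : Fin removed → Vec₂ (suc n)
    split          : ∀ i j → M i j ≡ Σ₂ removed (λ r → parts r i ∧ parts r j) xor rest i j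
    parts-in-column-space : ∀ r → InColumnSpace M (parts r)
    gained         : ℕ
    extend         : ∀ {r} → IndependentColumns rest r → IndependentColumns M (gained + r)
    grow           : ∀ {l r} → Bound l r (D₁ᵐ rest) → Bound (removed + l) (gained + r) M

reduce : ∀ {n} {M : Mat₂ (suc n) (suc n)} (red : Reduction M) →
  Decomposition (D₁ᵐ (Reduction.rest red)) →
  Decomposition M
reduce {n} {M} red dec = record
  { length          = removed + length
  ; vectors         = parts ++ (pad ∘ vectors)
  ; sum-of-squares  = squares
  ; in-column-space = in-column-space′
  ; rank            = gained + rank
  ; independent     = extend (suc ∘ proj₁ independent , unpad-independent {N = rest} _ (proj₂ independent))
  ; bound           = grow bound
  }
  where
  open Reduction red
  open Decomposition dec
  squares : SumOfSquares M (parts ++ (pad ∘ vectors))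
  squares i j = begin
    M i j                                                        ≡⟨ split i j ⟩
    Σ₂ removed (λ r → parts r i ∧ parts r j) xor rest i j        ≡⟨ cong (Σ₂ removed (λ r → parts r i ∧ parts r j) xor_)
                                                                     (pad-squares {N = rest} {w = vectors} rest-symmetric rest-row₀ sum-of-squares i j) ⟩
    Σ₂ removed (λ r → parts r i ∧ parts r j)
      xor Σ₂ length (λ r → pad (vectors r) i ∧ pad (vectors r) j) ≡⟨ sym (Σ₂-++ removed parts (pad ∘ vectors) (λ u → u i ∧ u j)) ⟩
    Σ₂ (removed + length) (λ r → (parts ++ (pad ∘ vectors)) r i ∧ (parts ++ (pad ∘ vectors)) r j) ∎
    where open ≡-Reasoning
  in-column-space′ : ∀ r → InColumnSpace M ((parts ++ (pad ∘ vectors)) r)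
  in-column-space′ r with splitAt removed r
  ... | inj₁ r′ = parts-in-column-space r′
  ... | inj₂ r′ = rest⊑ (pad-column-space {N = rest} rest-row₀ (in-column-space r′))

grow≤ : ∀ d e {l r} → 2 * d ≤ 3 * e → 2 * l ≤ 3 * r → 2 * (d + l) ≤ 3 * (e + r)
grow≤ d e {l} {r} de lr = subst₂ _≤_ (sym (*-distribˡ-+ 2 d l)) (sym (*-distribˡ-+ 3 e r)) (+-mono-≤ de lr)

grow<ˡ : ∀ d e {l r} → 2 * d < 3 * e → 2 * l ≤ 3 * r → 2 * (d + l) < 3 * (e + r)
grow<ˡ d e {l} {r} de lr = subst₂ _<_ (sym (*-distribˡ-+ 2 d l)) (sym (*-distribˡ-+ 3 e r)) (+-mono-<-≤ de lr)

grow<ʳ : ∀ d e {l r} → 2 * d ≤ 3 * e → 2 * l < 3 * r → 2 * (d + l) < 3 * (e + r)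
grow<ʳ d e {l} {r} de lr = subst₂ _<_ (sym (*-distribˡ-+ 2 d l)) (sym (*-distribˡ-+ 3 e r)) (+-mono-≤-< de lr)

extend-by-zero-row : ∀ {a c r} {M N : Mat₂ a c} {s : Fin c} {v : Vec₂ c} (w : Fin a) →
  ColumnOp M N s v → M w s ≡ true → (∀ j → N w j ≡ false) →
  IndependentColumns N r → IndependentColumns M (suc r)
extend-by-zero-row {s = s} w op Mws≡1 row≡0 (p , indep) =
  s ∷ p , independent-extend w op Mws≡1 p (row≡0 ∘ p) indep

alternating-from-block : ∀ {n} {M : Mat₂ (suc n) (suc n)} →
  M zero zero ≡ false → Alternating (D₁ᵐ M) → Alternating M
alternating-from-block M₀₀≡0 alt zero    = M₀₀≡0
alternating-from-block M₀₀≡0 alt (suc i) = alt i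

-- Pivoting at a diagonal entry Mᵢᵢ = 1: subtracting the square of column i
-- clears row and column i.
pivotOut : ∀ {n} → Mat₂ n n → Fin n → Mat₂ n n
pivotOut M i a b = M a b xor (M a i ∧ M b i)

pivotOut-columnOp : ∀ {n} (M : Mat₂ n n) i → ColumnOp M (pivotOut M i) i (λ b → M b i)
pivotOut-columnOp M i = columnOp λ a b → refl

pivotOut-symmetric : ∀ {n} {M : Mat₂ n n} i → Symmetric M → Symmetric (pivotOut M i)
pivotOut-symmetric {M = M} i symM a b = cong₂ _xor_ (symM a b) (∧-comm (M a i) (M b i))

pivotOut-row : ∀ {n} {M : Mat₂ n n} i → Symmetric M → M i i ≡ true → ∀ b → pivotOut M i i b ≡ false
pivotOut-row {M = M} i symM Mii≡1 b = begin
  M i b xor (M i i ∧ M b i)  ≡⟨ cong (λ m → M i b xor (m ∧ M b i)) Mii≡1 ⟩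
  M i b xor M b i            ≡⟨ cong (M i b xor_) (symM b i) ⟩
  M i b xor M i b            ≡⟨ xor-same (M i b) ⟩
  false                      ∎
  where open ≡-Reasoning

pivotOut-split : ∀ {n} (M : Mat₂ n n) i a b → M a b ≡ (M a i ∧ M b i) xor pivotOut M i a b
pivotOut-split M i a b = split (M a b) (M a i ∧ M b i)
  where
  split : ∀ m u → m ≡ u xor (m xor u)
  split = solve-∀ F₂-ring

-- The four kinds of reduction step, according to the shape of the first row.

zero-row-reduction : ∀ {n} (M : Mat₂ (suc n) (suc n)) → Symmetric M → (∀ j → M zero j ≡ false) →
  Reduction M
zero-row-reduction M symM row₀ = record
  { rest = M ; rest-symmetric = symM ; rest-row₀ = row₀ ; rest⊑ = λ c → c
  ; removed = 0 ; parts = [] ; split = λ _ _ → refl ; parts-in-column-space = λ ()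
  ; gained = 0 ; extend = λ c → c
  ; grow = λ { (strict b) → strict b
             ; (alternating b alt) → alternating b (alternating-from-block {M = M} (row₀ zero) alt) } }

-- M₀₀ = 1: pivot at 0; one square, one new independent column.
pivot-reduction : ∀ {n} (M : Mat₂ (suc n) (suc n)) → Symmetric M → M zero zero ≡ true → Reduction M
pivot-reduction M symM M₀₀≡1 = record
  { rest = pivotOut M zero
  ; rest-symmetric = pivotOut-symmetric zero symM
  ; rest-row₀ = row₀
  ; rest⊑ = columnOp-⊑ (pivotOut-columnOp M zero)
  ; removed = 1
  ; parts = (λ a → M a zero) ∷ []
  ; split = λ a b → trans (pivotOut-split M zero a b)
                          (cong (_xor pivotOut M zero a b) (sym (xor-identityʳ (M a zero ∧ M b zero))))
  ; parts-in-column-space = λ { zero → colspace-column M zero }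
  ; gained = 1
  ; extend = extend-by-zero-row zero (pivotOut-columnOp M zero) M₀₀≡1 row₀
  ; grow = λ b → strict (grow<ˡ 1 1 ≤-refl (bound-weaken b))
  }
  where
  row₀ = pivotOut-row zero symM M₀₀≡1

-- M₀₀ = 0, M₀q = 1, M_qq = 1: pivot at q, after which the entry at (0,0)
-- has become 1, and pivot at 0; two squares, two new independent columns.
double-pivot-reduction : ∀ {n} (M : Mat₂ (suc n) (suc n)) → Symmetric M → (q : Fin (suc n)) →
  M zero zero ≡ false → M zero q ≡ true → M q q ≡ true → Reduction M
double-pivot-reduction M symM q M₀₀≡0 M₀q≡1 Mqq≡1 = record
  { rest = N
  ; rest-symmetric = pivotOut-symmetric zero symK
  ; rest-row₀ = N-row₀
  ; rest⊑ = ⊑-trans {M = M} {K} {N} (columnOp-⊑ (pivotOut-columnOp K zero)) K⊑M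
  ; removed = 2
  ; parts = (λ a → M a q) ∷ (λ a → K a zero) ∷ []
  ; split = split
  ; parts-in-column-space = λ { zero → colspace-column M q
                             ; (suc zero) → K⊑M (colspace-column K zero) }
  ; gained = 2
  ; extend = extend-by-zero-row q (pivotOut-columnOp M q) Mqq≡1 (pivotOut-row q symM Mqq≡1)
           ∘ extend-by-zero-row zero (pivotOut-columnOp K zero) K₀₀≡1 N-row₀
  ; grow = λ b → strict (grow<ˡ 2 2 (n≤1+n 5) (bound-weaken b))
  }
  where
  K = pivotOut M q
  N = pivotOut K zero
  symK = pivotOut-symmetric q symM
  K⊑M : K ⊑ M
  K⊑M = columnOp-⊑ (pivotOut-columnOp M q)
  K₀₀≡1 : K zero zero ≡ true
  K₀₀≡1 = cong₂ (λ m u → m xor (u ∧ u)) M₀₀≡0 M₀q≡1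
  N-row₀ = pivotOut-row zero symK K₀₀≡1
  split : ∀ a b → M a b ≡ ((M a q ∧ M b q) xor ((K a zero ∧ K b zero) xor false)) xor N a b
  split a b = trans (pivotOut-split M q a b)
                (trans (cong ((M a q ∧ M b q) xor_) (pivotOut-split K zero a b))
                       (regroup (M a q ∧ M b q) (K a zero ∧ K b zero) (N a b)))
    where
    regroup : ∀ u v m → u xor (v xor m) ≡ (u xor (v xor false)) xor m
    regroup = solve-∀ F₂-ring

-- M₀₀ = 0, M₀q = 1, M_qq = 0 (a hyperbolic plane): with x, y the columns 0
-- and q, the rest M + x ⊗ y + y ⊗ x arises by two column operations, and
-- x ⊗ y + y ⊗ x = x ⊗ x + y ⊗ y + (x + y) ⊗ (x + y); three squares, two new
-- independent columns, and alternation of the rest passes to M.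
hyperbolic-reduction : ∀ {n} (M : Mat₂ (suc n) (suc n)) → Symmetric M → (q : Fin (suc n)) →
  M zero zero ≡ false → M zero q ≡ true → M q q ≡ false → Reduction M
hyperbolic-reduction M symM q M₀₀≡0 M₀q≡1 Mqq≡0 = record
  { rest = N
  ; rest-symmetric = N-symmetric
  ; rest-row₀ = N-row₀
  ; rest⊑ = ⊑-trans {M = M} {K} {N} (columnOp-⊑ K→N) (columnOp-⊑ M→K)
  ; removed = 3
  ; parts = x ∷ y ∷ (λ a → x a xor y a) ∷ []
  ; split = λ a b → split (M a b) (x a) (x b) (y a) (y b)
  ; parts-in-column-space = λ { zero → colspace-column M zero
                             ; (suc zero) → colspace-column M q
                             ; (suc (suc zero)) → colspace-xor {M = M} (colspace-column M zero) (colspace-column M q) }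
  ; gained = 2
  ; extend = extend-by-zero-row q M→K (trans (symM q zero) M₀q≡1) K-rowq
           ∘ extend-by-zero-row zero K→N K₀q≡1 N-row₀
  ; grow = λ { (strict b) → strict (grow<ʳ 3 2 ≤-refl b)
             ; (alternating b alt) → alternating (grow≤ 3 2 ≤-refl b)
                 (alternating-from-block {M = M} M₀₀≡0 (λ i → trans (diagonal (suc i)) (alt i))) }
  }
  where
  x y : Vec₂ _
  x a = M a zero
  y a = M a q
  K N : Mat₂ _ _
  K a b = M a b xor (x a ∧ y b)
  N a b = K a b xor (y a ∧ x b)

  Kaq≡ya : ∀ a → K a q ≡ y a
  Kaq≡ya a = trans (cong (λ m → M a q xor (x a ∧ m)) Mqq≡0)
                   (trans (cong (M a q xor_) (∧-zeroʳ (x a))) (xor-identityʳ (M a q)))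
  M→K : ColumnOp M K zero y
  M→K = columnOp λ _ _ → refl
  K→N : ColumnOp K N q x
  K→N = columnOp λ a b → cong (λ k → K a b xor (k ∧ x b)) (sym (Kaq≡ya a))

  K₀q≡1 : K zero q ≡ true
  K₀q≡1 = cong₂ (λ m u → m xor (u ∧ y q)) M₀q≡1 M₀₀≡0
  K-rowq : ∀ b → K q b ≡ false
  K-rowq b = trans (cong (λ u → M q b xor (u ∧ M b q)) (trans (symM q zero) M₀q≡1))
                   (trans (cong (M q b xor_) (symM b q)) (xor-same (M q b)))
  N-row₀ : ∀ b → N zero b ≡ false
  N-row₀ b = begin
    (M zero b xor (M zero zero ∧ y b)) xor (M zero q ∧ x b) ≡⟨ cong₂ (λ m u → (M zero b xor (m ∧ y b)) xor (u ∧ x b)) M₀₀≡0 M₀q≡1 ⟩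
    (M zero b xor false) xor M b zero                        ≡⟨ cong₂ _xor_ (xor-identityʳ (M zero b)) (symM b zero) ⟩
    M zero b xor M zero b                                    ≡⟨ xor-same (M zero b) ⟩
    false                                                    ∎
    where open ≡-Reasoning
  N-symmetric : Symmetric N
  N-symmetric a b = trans (cong (λ m → (m xor (x a ∧ y b)) xor (y a ∧ x b)) (symM a b))
                          (swap (M b a) (x a) (y a) (x b) (y b))
    where
    swap : ∀ m xa ya xb yb → (m xor (xa ∧ yb)) xor (ya ∧ xb) ≡ (m xor (xb ∧ ya)) xor (yb ∧ xa)
    swap = solve-∀ F₂-ring
  diagonal : ∀ a → M a a ≡ N a a
  diagonal a = unchanged (M a a) (x a) (y a)
    where
    unchanged : ∀ m u v → m ≡ (m xor (u ∧ v)) xor (v ∧ u)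
    unchanged = solve-∀ F₂-ring
  split : ∀ m xa xb ya yb → m ≡ ((xa ∧ xb) xor ((ya ∧ yb) xor (((xa xor ya) ∧ (xb xor yb)) xor false)))
                                 xor ((m xor (xa ∧ yb)) xor (ya ∧ xb))
  split = solve-∀ F₂-ring

reduction : ∀ {n} (M : Mat₂ (suc n) (suc n)) → Symmetric M → Reduction M
reduction M symM with M zero zero in M₀₀
... | true  = pivot-reduction M symM M₀₀
... | false with all? (λ q → M zero (suc q) ≟ false)
...   | yes row₀ = zero-row-reduction M symM λ { zero → M₀₀ ; (suc q) → row₀ q }
...   | no ¬row₀ with ¬∀⟶∃¬ _ _ (λ q → M zero (suc q) ≟ false) ¬row₀
...     | q , M₀q≢0 with M (suc q) (suc q) in Mqq
...       | true  = double-pivot-reduction M symM (suc q) M₀₀ (¬-not M₀q≢0) Mqq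
...       | false = hyperbolic-reduction M symM (suc q) M₀₀ (¬-not M₀q≢0) Mqq

decompose : ∀ n (M : Mat₂ n n) → Symmetric M → Decomposition M
decompose zero    M symM = record
  { length = 0 ; vectors = λ () ; sum-of-squares = λ () ; in-column-space = λ ()
  ; rank = 0 ; independent = (λ ()) , (λ _ _ ()) ; bound = alternating z≤n (λ ()) }
decompose (suc n) M symM =
  reduce red (decompose n (D₁ᵐ rest) (λ i j → rest-symmetric (suc i) (suc j)))
  where
  red = reduction M symM
  open Reduction red

-- Choosing an odd number of squares, at the cost of at most one more: the
-- zero vector may be added as a square.
record OddSquares {n} (M : Mat₂ n n) (maxLength : ℕ) : Set where
  field
    length          : ℕ
    length≤         : length ≤ maxLength
    vectors         : Fin length → Vec₂ n
    odd             : Σ₂ length (λ _ → true) ≡ true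
    sum-of-squares  : SumOfSquares M vectors
    in-column-space : ∀ r → InColumnSpace M (vectors r)

make-odd : ∀ {n} {M : Mat₂ n n} (dec : Decomposition M) → OddSquares M (suc (Decomposition.length dec))
make-odd dec with Σ₂ (Decomposition.length dec) (λ _ → true) in parity
... | true  = record
  { length = length ; length≤ = n≤1+n length ; vectors = vectors ; odd = parity
  ; sum-of-squares = sum-of-squares ; in-column-space = in-column-space }
  where open Decomposition dec
... | false = record
  { length = suc length ; length≤ = ≤-refl ; vectors = (λ _ → false) ∷ vectors
  ; odd = cong (true xor_) parity ; sum-of-squares = sum-of-squares
  ; in-column-space = λ { zero → colspace-zero ; (suc r) → in-column-space r } }
  where open Decomposition dec

-- A pseudo-quadratic A is determined by D₁ A: an odd sum of squares wᵣ ⊗ wᵣ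
-- of D₁ A gives the sum of squares (1, wᵣ) ⊗ (1, wᵣ) of A.
pseudo-quadratic-squares : ∀ {m l} {A : Mat₂ (suc m) (suc m)} {w : Fin l → Vec₂ m} →
  PseudoQuadratic A → Σ₂ l (λ _ → true) ≡ true → SumOfSquares (D₁ᵐ A) w →
  SumOfSquares A (λ r → true ∷ w r)
pseudo-quadratic-squares pq odd squares zero zero = trans corner (sym odd)
  where open PseudoQuadratic pq
pseudo-quadratic-squares {l = l} {w = w} pq odd squares zero (suc j) =
  trans (rowDiag j) (trans (squares j j) (Σ₂-cong l (λ r → ∧-idem (w r j))))
  where open PseudoQuadratic pq
pseudo-quadratic-squares {l = l} {w = w} pq odd squares (suc i) zero =
  trans (colDiag i) (trans (squares i i)
    (Σ₂-cong l (λ r → trans (∧-idem (w r i)) (sym (∧-identityʳ (w r i))))))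
  where open PseudoQuadratic pq
pseudo-quadratic-squares pq odd squares (suc i) (suc j) = squares i j

if-∧ : ∀ b x y → (if b then x ∧ y else false) ≡ (if b then x else false) ∧ y
if-∧ true  x y = refl
if-∧ false x y = refl

superposition : ∀ {m l} (q : Quadratic m) (A : Mat₂ (suc m) (suc m)) (a : Fin l → Vec₂ (suc m)) →
  A zero zero ≡ true → (∀ r → a r zero ≡ true) → SumOfSquares A a →
  ⟨ matrixForm q , A ⟩ ≡ false → SatisfiesInSuperposition q (λ r → D₁ᵛ (a r))
superposition {m} {l} q A a A₀₀≡1 a₀≡1 squares form≡0 = begin
  const q xor (Σ₂ m (λ i → lin q i ∧ Σ₂ l (λ r → a r (suc i)))
    xor Σ₂< m (λ i j → quad q i j ∧ Σ₂ l (λ r → a r (suc i) ∧ a r (suc j))))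
    ≡⟨ cong₂ _xor_ constant (cong₂ _xor_ linear quadratic) ⟩
  (const q ∧ A zero zero) xor (Σ₂ m (λ j → lin q j ∧ A zero (suc j))
    xor Σ₂ m (λ i → Σ₂ m (λ j → (if toℕ i <ᵇ toℕ j then quad q i j else false) ∧ A (suc i) (suc j))))
    ≡⟨ sym (xor-assoc (const q ∧ A zero zero) _ _) ⟩
  ⟨ matrixForm q , A ⟩
    ≡⟨ form≡0 ⟩
  false ∎
  where
  open ≡-Reasoning
  constant : const q ≡ const q ∧ A zero zero
  constant = sym (trans (cong (const q ∧_) A₀₀≡1) (∧-identityʳ (const q)))
  linear : Σ₂ m (λ i → lin q i ∧ Σ₂ l (λ r → a r (suc i))) ≡ Σ₂ m (λ j → lin q j ∧ A zero (suc j))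
  linear = Σ₂-cong m λ j → cong (lin q j ∧_)
    (sym (trans (squares zero (suc j)) (Σ₂-cong l (λ r → cong (_∧ a r (suc j)) (a₀≡1 r)))))
  quadratic : Σ₂< m (λ i j → quad q i j ∧ Σ₂ l (λ r → a r (suc i) ∧ a r (suc j)))
    ≡ Σ₂ m (λ i → Σ₂ m (λ j → (if toℕ i <ᵇ toℕ j then quad q i j else false) ∧ A (suc i) (suc j)))
  quadratic = Σ₂-cong m λ i → Σ₂-cong m λ j →
    trans (if-∧ (toℕ i <ᵇ toℕ j) (quad q i j) _)
          (cong ((if toℕ i <ᵇ toℕ j then quad q i j else false) ∧_) (sym (squares (suc i) (suc j))))

columnOp-identity : ∀ {a c} (M : Mat₂ a c) (s : Fin c) → ColumnOp M M s (λ _ → false)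
columnOp-identity M s = columnOp λ i j →
  sym (trans (cong (M i j xor_) (∧-zeroʳ (M i s))) (xor-identityʳ (M i j)))

-- The columns found for D₁ A are independent in A, and in the alternating
-- case so is the first column together with them (its top entry A₁₁ = 1 is
-- the only non-zero one in row 1 among them); hence 2l < 3k.
length-bound : ∀ {m k} {A : Mat₂ (suc m) (suc m)} → PseudoQuadratic A → RankAtMost A k →
  (dec : Decomposition (D₁ᵐ A)) → 2 * Decomposition.length dec < 3 * k
length-bound {k = k} {A} pq rankA dec
  with Decomposition.independent dec | Decomposition.bound dec
... | p , indep | strict b = <-≤-trans b (*-monoʳ-≤ 3 (rankA _ (suc ∘ p) (unpad-independent {N = A} p indep)))
... | p , indep | alternating b alt =
  ≤-<-trans b (<-≤-trans (*-monoʳ-< 3 (n<1+n _)) (*-monoʳ-≤ 3 (rankA _ (zero ∷ suc ∘ p) indep₀)))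
  where
  open PseudoQuadratic pq
  indep₀ : LinearlyIndependent (columnsAt A (zero ∷ suc ∘ p))
  indep₀ = independent-extend zero (columnOp-identity A zero) corner (suc ∘ p)
             (λ t → trans (rowDiag (p t)) (alt (p t))) (unpad-independent {N = A} p indep)
-- From l ≤ l₀ + 1 and 2l₀ < 3k: 2l < 3k + 2, i.e. l < 3k/2 + 1.
final-bound : ∀ {l l₀ k} → l ≤ suc l₀ → 2 * l₀ < 3 * k → 2 * l < 3 * k + 2
final-bound {l} {l₀} {k} l≤ b = begin-strict
  2 * l       ≤⟨ *-monoʳ-≤ 2 l≤ ⟩
  2 * suc l₀  ≡⟨ *-suc 2 l₀ ⟩
  2 + 2 * l₀  <⟨ +-monoʳ-< 2 b ⟩
  2 + 3 * k   ≡⟨ +-comm 2 (3 * k) ⟩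
  3 * k + 2   ∎
  where open ≤-Reasoning

mainTheorem4 : (m s k : ℕ) (q : Fin s → Quadratic m)
    (A : Mat₂ (suc m) (suc m)) →
    PseudoQuadratic A →
    RankAtMost A k →
    (∀ i → ⟨ matrixForm (q i) , A ⟩ ≡ false) →
    ∃ λ (l : ℕ) → ∃ λ (a : Fin l → Vec₂ (suc m)) →
      (2 * l < 3 * k + 2)
      × (∀ i j → A i j ≡ Σ₂ l (λ r → (a r ⊗ a r) i j))
      × (∀ r → a r zero ≡ true)
      × (∀ r → InColumnSpace (D₁ᵐ A) (D₁ᵛ (a r)))
      × (∀ i → SatisfiesInSuperposition (q i) (λ r → D₁ᵛ (a r)))
mainTheorem4 m s k q A pq rankA forms≡0 =
  length , a , final-bound {k = k} length≤ (length-bound pq rankA dec) , squares , (λ _ → refl) , in-column-space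
  , λ i → superposition (q i) A a corner (λ _ → refl) squares (forms≡0 i)
  where
  open PseudoQuadratic pq
  dec : Decomposition (D₁ᵐ A)
  dec = decompose m (D₁ᵐ A) (λ i j → symmetric (suc i) (suc j))
  open OddSquares (make-odd dec)
  a : Fin length → Vec₂ (suc m)
  a r = true ∷ vectors r
  squares : SumOfSquares A a
  squares = pseudo-quadratic-squares {w = vectors} pq odd sum-of-squares
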